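{- The complete symmetric digraph $K_{22}^\ast$ admits a resolvable decomposition into directed $11$-cycles.
   Context: $K_n^\ast$ denotes the complete symmetric digraph of order $n$: it has $n$ vertices and, for each pair of distinct vertices $u,v$, both arcs $(u,v)$ and $(v,u)$. A decomposition of a digraph $D$ is a collection of subdigraphs whose arc sets partition the arc set of $D$. A resolution class is a subcollection whose members' vertex sets partition the vertex set of $D$; a decomposition is resolvable if it can be partitioned into resolution classes. -}

module Defs where

open import Data.Nat using (ℕ; suc; NonZero)
open import Data.Nat.DivMod using (_mod_)
open import Data.Fin using (Fin; toℕ)
open import Data.List using (List; length; lookup; concat)
open import Data.Product using (Σ; ∃; _×_; _,_; proj₁)
open import Function.Definitions using (Injective)
open import Relation.Binary.PropositionalEquality using (_≡_)
open import Relation.Nullary using (¬_)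

next : ∀ {k} .{{_ : NonZero k}} → Fin k → Fin k
next {k} i = suc (toℕ i) mod k

-- A directed k-cycle in a digraph on vertex set Fin n (here inside K_n^*):
-- an injective cyclic sequence of k vertices c 0, c 1, ..., c (k-1).
DiCycle : ℕ → ℕ → Set
DiCycle k n = Σ (Fin k → Fin n) λ c → Injective _≡_ _≡_ c

IsArc : ∀ {k n} .{{_ : NonZero k}} → DiCycle k n → Fin n → Fin n → Set
IsArc (c , _) u v = ∃ λ i → c i ≡ u × c (next i) ≡ v

IsVertex : ∀ {k n} → DiCycle k n → Fin n → Set
IsVertex (c , _) v = ∃ λ i → c i ≡ v

ExactlyOne : ∀ {A : Set} → (A → Set) → List A → Set
ExactlyOne P xs =
  Σ (Fin (length xs)) λ i → P (lookup xs i) × (∀ j → P (lookup xs j) → j ≡ i)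

-- A collection of directed k-cycles (listed with multiplicity) is a
-- decomposition of K_n^*: every arc (u , v), u ≠ v, of K_n^* lies in exactly
-- one member. (Every arc of a cycle is an arc of K_n^* since c is injective.)
IsDecompositionKn* : ∀ {k} .{{_ : NonZero k}} n → List (DiCycle k n) → Set
IsDecompositionKn* n D = ∀ (u v : Fin n) → ¬ (u ≡ v) → ExactlyOne (λ C → IsArc C u v) D

IsResolutionClass : ∀ {k} n → List (DiCycle k n) → Set
IsResolutionClass n R = ∀ (v : Fin n) → ExactlyOne (λ C → IsVertex C v) R

data ResolvableCycleDecompositionK* (k : ℕ) .{{_ : NonZero k}} (n : ℕ) : Set where
  resolvable : (classes : List (List (DiCycle k n)))
             → (∀ (i : Fin (length classes)) → IsResolutionClass n (lookup classes i))
             → IsDecompositionKn* n (concat classes)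
             → ResolvableCycleDecompositionK* k n

module Submission where

-- Label the vertices of K₂₂* by ℤ₇ × ℤ₃ ∪ {∞}. Three base resolution classes, each a pair
-- of vertex-disjoint 11-cycles, are chosen so that their 66 arcs meet each of the 66 orbits
-- of arcs under (a , b) ↦ (a + 1 , b), ∞ ↦ ∞ exactly once. Developing them under this
-- ℤ₇-action gives 21 resolution classes whose 42 cycles cover all 462 arcs of K₂₂* exactly
-- once; the final counts are checked by evaluation.

open import Defs
open import Data.Bool using (if_then_else_)
open import Data.Empty using (⊥-elim)
open import Data.Fin using (Fin; #_; zero; suc; toℕ)
open import Data.Fin.Properties using (_≟_; any?; all?)
open import Data.List using (List; []; _∷_; length; lookup; concat; concatMap; filter; iterate; map)
open import Data.List.Membership.Propositional.Properties using (∈-lookup)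
open import Data.List.Relation.Unary.All as All using (All)
open import Data.Nat as ℕ using (ℕ; NonZero; suc; _*_; _+_; _<ᵇ_)
open import Data.Nat.DivMod using (_/_; _%_; _mod_)
open import Data.Product using (_,_)
open import Data.Vec as Vec using (Vec; []; _∷_)
open import Function using (_∘_)
open import Function.Definitions using (Injective)
open import Relation.Binary.Definitions using (Decidable)
open import Relation.Binary.PropositionalEquality using (_≡_; _≢_; refl; cong)
open import Relation.Nullary using (Dec; yes; no; ¬_; ¬?; _×-dec_; _→-dec_)
open import Relation.Nullary.Decidable using (True; toWitness)
open import Relation.Unary using () renaming (Decidable to Decidable₁)

module _ {A : Set} {P : A → Set} (P? : Decidable₁ P) where

  length-filter≡0⇒¬lookup : ∀ xs → length (filter P? xs) ≡ 0 → ∀ i → ¬ P (lookup xs i)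
  length-filter≡0⇒¬lookup (x ∷ xs) _ zero px with P? x
  ... | no ¬px = ¬px px
  length-filter≡0⇒¬lookup (x ∷ xs) len≡0 (suc i) with P? x
  ... | no _ = length-filter≡0⇒¬lookup xs len≡0 i

  length-filter≡1⇒ExactlyOne : ∀ xs → length (filter P? xs) ≡ 1 → ExactlyOne P xs
  length-filter≡1⇒ExactlyOne (x ∷ xs) len≡1 with P? x
  ... | yes px = zero , px , unique
    where
    unique : ∀ j → P (lookup (x ∷ xs) j) → j ≡ zero
    unique zero    _  = refl
    unique (suc j) pj = ⊥-elim (length-filter≡0⇒¬lookup xs (cong ℕ.pred len≡1) j pj)
  ... | no ¬px with length-filter≡1⇒ExactlyOne xs len≡1
  ... | i , pi , unique = suc i , pi , unique′
    where
    unique′ : ∀ j → P (lookup (x ∷ xs) j) → j ≡ suc i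
    unique′ zero    px = ⊥-elim (¬px px)
    unique′ (suc j) pj = cong suc (unique j pj)

module _ {k n : ℕ} .{{_ : NonZero k}} where

  isArc? : (C : DiCycle k n) → Decidable (IsArc C)
  isArc? (c , _) u v = any? λ i → (c i ≟ u) ×-dec (c (next i) ≟ v)

  arcCount : List (DiCycle k n) → Fin n → Fin n → ℕ
  arcCount D u v = length (filter (λ C → isArc? C u v) D)

  arcCount≡1? : ∀ D → Dec (∀ u v → u ≢ v → arcCount D u v ≡ 1)
  arcCount≡1? D = all? λ u → all? λ v → ¬? (u ≟ v) →-dec (arcCount D u v ℕ.≟ 1)

  arcCount≡1⇒IsDecompositionKn* : ∀ D → (∀ u v → u ≢ v → arcCount D u v ≡ 1) →
                                   IsDecompositionKn* n D
  arcCount≡1⇒IsDecompositionKn* D counts u v u≢v =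
    length-filter≡1⇒ExactlyOne (λ C → isArc? C u v) D (counts u v u≢v)

module _ {k n : ℕ} where

  isVertex? : (C : DiCycle k n) → Decidable₁ (IsVertex C)
  isVertex? (c , _) v = any? λ i → c i ≟ v

  vertexCount : List (DiCycle k n) → Fin n → ℕ
  vertexCount R v = length (filter (λ C → isVertex? C v) R)

  vertexCount≡1? : ∀ R → Dec (∀ v → vertexCount R v ≡ 1)
  vertexCount≡1? R = all? λ v → vertexCount R v ℕ.≟ 1

  vertexCount≡1⇒IsResolutionClass : ∀ R → (∀ v → vertexCount R v ≡ 1) → IsResolutionClass n R
  vertexCount≡1⇒IsResolutionClass R counts v =
    length-filter≡1⇒ExactlyOne (λ C → isVertex? C v) R (counts v)

injective? : ∀ {m n} (f : Fin m → Fin n) → Dec (∀ x y → f x ≡ f y → x ≡ y)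
injective? f = all? λ x → all? λ y → (f x ≟ f y) →-dec (x ≟ y)

cycle : ∀ {k n} (c : Vec (Fin n) k) → True (injective? (Vec.lookup c)) → DiCycle k n
cycle c c-inj = Vec.lookup c , λ {x} {y} → toWitness c-inj x y

mapCycle : ∀ {k n} (f : Fin n → Fin n) → Injective _≡_ _≡_ f → DiCycle k n → DiCycle k n
mapCycle f f-inj (c , c-inj) = f ∘ c , c-inj ∘ f-inj

develop : ∀ {k n} (f : Fin n → Fin n) → Injective _≡_ _≡_ f → ℕ →
          List (DiCycle k n) → List (List (DiCycle k n))
develop f f-inj order R = iterate (map (mapCycle f f-inj)) R order

-- Vertex k b + a stands for (a , b) ∈ ℤₖ × ℤₘ and the last vertex m k for ∞.
rotate : ∀ m k .{{_ : NonZero k}} → Fin (suc (m * k)) → Fin (suc (m * k))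
rotate m k v =
  if toℕ v <ᵇ m * k then (k * (toℕ v / k) + suc (toℕ v) % k) mod suc (m * k) else v

rotate-3-7-injective : Injective _≡_ _≡_ (rotate 3 7)
rotate-3-7-injective {x} {y} = toWitness {a? = injective? (rotate 3 7)} _ x y

baseClasses : List (List (DiCycle 11 22))
baseClasses =
  (cycle (# 11 ∷ # 13 ∷ # 16 ∷ # 21 ∷ # 19 ∷ # 8 ∷ # 15 ∷ # 5 ∷ # 10 ∷ # 4 ∷ # 2 ∷ []) _ ∷
   cycle (# 9 ∷ # 20 ∷ # 1 ∷ # 12 ∷ # 18 ∷ # 3 ∷ # 17 ∷ # 14 ∷ # 0 ∷ # 7 ∷ # 6 ∷ []) _ ∷ []) ∷
  (cycle (# 3 ∷ # 16 ∷ # 14 ∷ # 20 ∷ # 8 ∷ # 13 ∷ # 12 ∷ # 9 ∷ # 0 ∷ # 18 ∷ # 19 ∷ []) _ ∷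
   cycle (# 21 ∷ # 10 ∷ # 11 ∷ # 6 ∷ # 15 ∷ # 2 ∷ # 1 ∷ # 4 ∷ # 5 ∷ # 17 ∷ # 7 ∷ []) _ ∷ []) ∷
  (cycle (# 0 ∷ # 17 ∷ # 8 ∷ # 5 ∷ # 21 ∷ # 6 ∷ # 14 ∷ # 16 ∷ # 19 ∷ # 11 ∷ # 7 ∷ []) _ ∷
   cycle (# 9 ∷ # 18 ∷ # 12 ∷ # 20 ∷ # 13 ∷ # 2 ∷ # 10 ∷ # 15 ∷ # 4 ∷ # 1 ∷ # 3 ∷ []) _ ∷ []) ∷
  []

classes : List (List (DiCycle 11 22))
classes = concatMap (develop (rotate 3 7) rotate-3-7-injective 7) baseClasses

lemma3p3 : ResolvableCycleDecompositionK* 11 22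
lemma3p3 = resolvable classes
  (λ i → All.lookup everyClassResolves (∈-lookup i))
  (arcCount≡1⇒IsDecompositionKn* (concat classes) (toWitness {a? = arcCount≡1? (concat classes)} _))
  where
  everyClassResolves : All (IsResolutionClass 22) classes
  everyClassResolves = All.map (λ {R} → vertexCount≡1⇒IsResolutionClass R)
    (toWitness {a? = All.all? vertexCount≡1? classes} _)
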